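{- Let $K_n$ be the directed graph on $[n]$ with edge set $\{(i,j):1\le i<j\le n\}$ and let $H\subseteq K_n$ be a subgraph. Then $\tilde Q_H$ is a face of $\tilde Q_{K_n}$ if and only if there are integers $0=n_0<n_1<\dots<n_\ell<n_{\ell+1}=n$ such that $H=K_{[1,n_1]}\sqcup K_{[n_1+1,n_2]}\sqcup\dots\sqcup K_{[n_\ell+1,n]}$, i.e. $E(H)=\{(i,j): i<j \text{ and } i,j\in[n_k+1,n_{k+1}] \text{ for some } k\}$.
   Context: $\tilde Q_G=\mathrm{conv}\{\mathbf 0,\mathbf e_i-\mathbf e_j:(i,j)\in E(G)\}\subset\mathbb R^n$. A subgraph has the same vertex set and a subset of the edges. $[a,b]=\{a,a+1,\dots,b\}$ and $K_{[a,b]}$ is the complete graph on $[a,b]$ with edges $(i,j)$, $i<j$.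
   Formalization: The polytopes $\tilde Q_H$ and $\tilde Q_{K_n}$ are taken in ℚ^n rather than ℝ^n, and the inequalities cutting out faces have rational coefficients and rational right-hand sides. -}

module Defs where

open import Data.Nat as ℕ using (ℕ; zero; suc)
open import Data.Fin using (Fin; toℕ; zero; suc; inject₁) renaming (_≟_ to _≟ᶠ_)
open import Data.Rational using (ℚ; 0ℚ; 1ℚ; _+_; _*_; _-_; _≤_)
open import Data.Product using (Σ; ∃; ∃-syntax; _×_; _,_)
open import Data.Sum using (_⊎_)
open import Relation.Binary.PropositionalEquality using (_≡_)
open import Relation.Nullary using (yes; no)
open import Function.Bundles using (_⇔_)

-- Points of ℚ^n (vertices of [n] are Fin n, vertex v corresponds to v+1 ∈ [n]).
Point : ℕ → Set
Point n = Fin n → ℚ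

∑ : ∀ {m} → (Fin m → ℚ) → ℚ
∑ {zero}  f = 0ℚ
∑ {suc m} f = f zero + ∑ (λ k → f (suc k))

_·_ : ∀ {n} → Point n → Point n → ℚ
c · x = ∑ (λ t → c t * x t)

𝟎 : ∀ {n} → Point n
𝟎 _ = 0ℚ

e : ∀ {n} → Fin n → Point n
e i t with i ≟ᶠ t
... | yes _ = 1ℚ
... | no  _ = 0ℚ

_≋_ : ∀ {n} → Point n → Point n → Set
x ≋ y = ∀ t → x t ≡ y t

Conv : ∀ {n} → (Point n → Set) → Point n → Set
Conv {n} S x =
  ∃[ m ] Σ (Fin m → Point n) λ p → Σ (Fin m → ℚ) λ w →
    (∀ k → S (p k)) × (∀ k → 0ℚ ≤ w k) × (∑ w ≡ 1ℚ) ×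
    (∀ t → ∑ (λ k → w k * p k t) ≡ x t)

Graph : ℕ → Set₁
Graph n = Fin n → Fin n → Set

K : ∀ n → Graph n
K n i j = toℕ i ℕ.< toℕ j

SubgraphOfK : ∀ {n} → Graph n → Set
SubgraphOfK {n} H = ∀ i j → H i j → K n i j

Qtilde : ∀ {n} → Graph n → Point n → Set
Qtilde {n} G = Conv λ x → (x ≋ 𝟎) ⊎ (∃[ i ] ∃[ j ] (G i j × (x ≋ (λ t → e i t - e j t))))

IsFace : ∀ {n} → (Point n → Set) → (Point n → Set) → Set
IsFace {n} F P = Σ (Point n) λ c → Σ ℚ λ b →
  (∀ x → P x → (c · x) ≤ b) × (∀ x → F x ⇔ (P x × (c · x ≡ b)))

-- Vertex v : Fin n is v+1 ∈ [n],
-- so v+1 ∈ [n_k+1, n_{k+1}] iff n_k ≤ toℕ v < n_{k+1}.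
IsBlockDecomposition : ∀ n → Graph n → Set
IsBlockDecomposition n H =
  ∃[ ℓ ] Σ (Fin (suc (suc ℓ)) → ℕ) λ ns →
    (ns zero ≡ 0) × (ns (Data.Fin.fromℕ (suc ℓ)) ≡ n) ×
    (∀ (k : Fin (suc ℓ)) → ns (inject₁ k) ℕ.< ns (suc k)) ×
    (∀ i j → H i j ⇔ (toℕ i ℕ.< toℕ j ×
        ∃[ k ] ((ns (inject₁ k) ℕ.≤ toℕ i) × (toℕ i ℕ.< ns (suc k)) ×
                (ns (inject₁ k) ℕ.≤ toℕ j) × (toℕ j ℕ.< ns (suc k)))))

module Submission where

-- For a subgraph H ⊆ K_n the following are equivalent:
--   (1) Q̃_H is a face of Q̃_{K_n};
--   (2) H is a level graph: for a weakly increasing c : [n] → ℚ, the edges of H are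
--       exactly the pairs i < j with cᵢ = cⱼ;
--   (3) H is a disjoint union of complete graphs on consecutive intervals.
-- (2) ⇒ (1): c · x ≤ 0 is valid on the generators 0, eᵢ - eⱼ of Q̃_{K_n}, and a hull
-- meets the hyperplane of such a functional in the hull of the generators on it
-- (hull-face).  (1) ⇒ (2): the origin lies on the face, so the face is cut out by some
-- c · x ≤ 0; validity on eᵢ - eⱼ makes c increasing, and eᵢ - eⱼ lies in Q̃_H only for
-- edges (i, j) of H (edge-of-hull).  (2) ⇔ (3): the level sets of a monotone function
-- on [0, n] are consecutive blocks (LevelSets.levelBlocks), and the block index is a
-- monotone function whose level sets are the blocks (blockIndex).

open import Defs
open import Data.Nat using (ℕ; suc)
open import Function.Bundles using (_⇔_)

open import Data.Empty using (⊥-elim)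
open import Data.Fin as Fin using (Fin; zero; suc; toℕ; inject₁; fromℕ)
import Data.Fin.Properties as FinP
import Data.Integer as ℤ
import Data.Integer.Properties as ℤP
open import Data.Nat as ℕ using (zero; z≤n; _<?_)
open import Data.Nat.DivMod using (_mod_; m<n⇒m%n≡m)
import Data.Nat.Properties as ℕP
open import Data.Product using (Σ; ∃-syntax; _×_; _,_; proj₁; proj₂)
open import Data.Rational as ℚ using (ℚ; 0ℚ; 1ℚ; _+_; _*_; _-_; -_)
open import Data.Rational.Literals using (fromℤ)
import Data.Rational.Properties as ℚP
open import Data.Rational.Solver using (module +-*-Solver)
open import Data.Sum using (_⊎_; inj₁; inj₂)
open import Data.Unit using (tt)
open import Data.Vec.Functional using ([]; _∷_; tail)
open import Function using (_∘_)
open import Function.Bundles using (mk⇔; Equivalence)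
open import Function.Properties.Equivalence using (⇔-setoid)
import Function.Properties.Equivalence as Eq
open import Level using (0ℓ)
open import Relation.Binary.Definitions using (DecidableEquality; tri<; tri≈; tri>)
open import Relation.Binary.PropositionalEquality
open import Relation.Binary.Structures using (IsPartialOrder)
open import Relation.Nullary using (Dec; yes; no)
open import Relation.Nullary.Decidable using (toWitness)

open Equivalence using (to; from)
open import Algebra.Properties.Group ℚP.+-0-group
  using () renaming (x∙y⁻¹≈ε⇒x≈y to sub≡0⇒≡; x≈y⇒x∙y⁻¹≈ε to ≡⇒sub≡0)

0≤1 : 0ℚ ℚ.≤ 1ℚ
0≤1 = toWitness {a? = 0ℚ ℚP.≤? 1ℚ} tt

≤⇒sub≤0 : ∀ {x y} → x ℚ.≤ y → x - y ℚ.≤ 0ℚ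
≤⇒sub≤0 {x} {y} x≤y = subst (x - y ℚ.≤_) (ℚP.+-inverseʳ y) (ℚP.+-monoˡ-≤ (- y) x≤y)

sub≤0⇒≤ : ∀ {x y} → x - y ℚ.≤ 0ℚ → x ℚ.≤ y
sub≤0⇒≤ {x} {y} x-y≤0 = subst₂ ℚ._≤_ (sub-add x y) (ℚP.+-identityˡ y) (ℚP.+-monoˡ-≤ y x-y≤0)
  where
  open +-*-Solver
  sub-add : ∀ x y → (x - y) + y ≡ x
  sub-add = solve 2 (λ x y → (x :- y) :+ y := x) refl

sub-mono-≤ : ∀ {x x′ y y′} → x ℚ.≤ x′ → y′ ℚ.≤ y → x - y ℚ.≤ x′ - y′
sub-mono-≤ x≤x′ y′≤y = ℚP.+-mono-≤ x≤x′ (ℚP.neg-antimono-≤ y′≤y)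

nonpos-sum-zero : ∀ {x y} → x ℚ.≤ 0ℚ → y ℚ.≤ 0ℚ → x + y ≡ 0ℚ → x ≡ 0ℚ
nonpos-sum-zero {x} {y} x≤0 y≤0 x+y≡0 =
  ℚP.≤-antisym x≤0 (subst₂ ℚ._≤_ x+y≡0 (ℚP.+-identityʳ x) (ℚP.+-monoʳ-≤ x y≤0))

weight*nonpos : ∀ {w v} → 0ℚ ℚ.≤ w → v ℚ.≤ 0ℚ → w * v ℚ.≤ 0ℚ
weight*nonpos {w} {v} 0≤w v≤0 = ℚP.nonPositive⁻¹ (w * v)
  {{ℚP.nonNeg*nonPos⇒nonPos w {{ℚ.nonNegative 0≤w}} v {{ℚ.nonPositive v≤0}}}}

weight-vanishes : ∀ {w v} → 0ℚ ℚ.≤ w → v ℚ.< 0ℚ → w * v ≡ 0ℚ → w ≡ 0ℚ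
weight-vanishes {w} {v} 0≤w v<0 wv≡0 with ℚP.<-cmp w 0ℚ
... | tri< w<0 _ _ = ⊥-elim (ℚP.<-irrefl refl (ℚP.<-≤-trans w<0 0≤w))
... | tri≈ _ w≡0 _ = w≡0
... | tri> _ _ 0<w = ⊥-elim (ℚP.<-irrefl wv≡0 (ℚP.negative⁻¹ (w * v)
  {{ℚP.pos*neg⇒neg w {{ℚ.positive 0<w}} v {{ℚ.negative v<0}}}}))

∑-cong : ∀ {m} {f g : Fin m → ℚ} → (∀ k → f k ≡ g k) → ∑ f ≡ ∑ g
∑-cong {zero}  _   = refl
∑-cong {suc m} f≗g = cong₂ _+_ (f≗g zero) (∑-cong (f≗g ∘ suc))

∑-zero : ∀ {m} {f : Fin m → ℚ} → (∀ k → f k ≡ 0ℚ) → ∑ f ≡ 0ℚ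
∑-zero {zero}  _   = refl
∑-zero {suc m} f≗0 = cong₂ _+_ (f≗0 zero) (∑-zero (f≗0 ∘ suc))

∑-+ : ∀ {m} (f g : Fin m → ℚ) → ∑ (λ k → f k + g k) ≡ ∑ f + ∑ g
∑-+ {zero}  f g = refl
∑-+ {suc m} f g = trans (cong ((f zero + g zero) +_) (∑-+ (f ∘ suc) (g ∘ suc)))
  (interchange (f zero) (g zero) (∑ (f ∘ suc)) (∑ (g ∘ suc)))
  where
  open +-*-Solver
  interchange : ∀ a b s t → (a + b) + (s + t) ≡ (a + s) + (b + t)
  interchange = solve 4 (λ a b s t → (a :+ b) :+ (s :+ t) := (a :+ s) :+ (b :+ t)) refl

∑-* : ∀ {m} (a : ℚ) (f : Fin m → ℚ) → ∑ (λ k → a * f k) ≡ a * ∑ f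
∑-* {zero}  a f = sym (ℚP.*-zeroʳ a)
∑-* {suc m} a f = trans (cong ((a * f zero) +_) (∑-* a (f ∘ suc)))
  (sym (ℚP.*-distribˡ-+ a (f zero) (∑ (f ∘ suc))))

∑-neg : ∀ {m} (f : Fin m → ℚ) → ∑ (λ k → - f k) ≡ - ∑ f
∑-neg {zero}  f = refl
∑-neg {suc m} f = trans (cong ((- f zero) +_) (∑-neg (f ∘ suc)))
  (sym (ℚP.neg-distrib-+ (f zero) (∑ (f ∘ suc))))

∑-swap : ∀ {m m′} (g : Fin m → Fin m′ → ℚ) → ∑ (λ t → ∑ (g t)) ≡ ∑ (λ k → ∑ (λ t → g t k))
∑-swap {zero} {m′} g = sym (∑-zero {m′} (λ _ → refl))
∑-swap {suc m} g = trans (cong (∑ (g zero) +_) (∑-swap (g ∘ suc)))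
  (sym (∑-+ (g zero) (λ k → ∑ (λ t → g (suc t) k))))

∑-mono : ∀ {m} {f g : Fin m → ℚ} → (∀ k → f k ℚ.≤ g k) → ∑ f ℚ.≤ ∑ g
∑-mono {zero}  _   = ℚP.≤-refl
∑-mono {suc m} f≤g = ℚP.+-mono-≤ (f≤g zero) (∑-mono (f≤g ∘ suc))

∑-nonpos : ∀ {m} {f : Fin m → ℚ} → (∀ k → f k ℚ.≤ 0ℚ) → ∑ f ℚ.≤ 0ℚ
∑-nonpos {m} {f} f≤0 = subst (∑ f ℚ.≤_) (∑-zero {m} (λ _ → refl)) (∑-mono f≤0)

∑-nonpos-zero : ∀ {m} {f : Fin m → ℚ} → (∀ k → f k ℚ.≤ 0ℚ) → ∑ f ≡ 0ℚ → ∀ k → f k ≡ 0ℚ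
∑-nonpos-zero {suc m} f≤0 ∑≡0 zero = nonpos-sum-zero (f≤0 zero) (∑-nonpos (f≤0 ∘ suc)) ∑≡0
∑-nonpos-zero {suc m} {f} f≤0 ∑≡0 (suc k) = ∑-nonpos-zero (f≤0 ∘ suc) ∑tail≡0 k
  where
  ∑tail≡0 = nonpos-sum-zero (∑-nonpos (f≤0 ∘ suc)) (f≤0 zero)
    (trans (ℚP.+-comm (∑ (f ∘ suc)) (f zero)) ∑≡0)

∑-single : ∀ {m} {f : Fin m → ℚ} (i : Fin m) → (∀ t → i ≢ t → f t ≡ 0ℚ) → ∑ f ≡ f i
∑-single {suc m} {f} zero    off = trans (cong (f zero +_) (∑-zero (λ k → off (suc k) λ ())))
  (ℚP.+-identityʳ (f zero))
∑-single {suc m} {f} (suc i) off = trans (cong₂ _+_ (off zero λ ()) (∑-single i (λ t i≢t → off (suc t) (i≢t ∘ FinP.suc-injective))))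
  (ℚP.+-identityˡ (f (suc i)))

e-on : ∀ {n} (i : Fin n) → e i i ≡ 1ℚ
e-on i with i Fin.≟ i
... | yes _   = refl
... | no i≢i = ⊥-elim (i≢i refl)

e-off : ∀ {n} {i t : Fin n} → i ≢ t → e i t ≡ 0ℚ
e-off {i = i} {t} i≢t with i Fin.≟ t
... | yes i≡t = ⊥-elim (i≢t i≡t)
... | no _    = refl

e-nonneg : ∀ {n} (i t : Fin n) → 0ℚ ℚ.≤ e i t
e-nonneg i t with i Fin.≟ t
... | yes _ = 0≤1
... | no _  = ℚP.≤-refl

e-≤1 : ∀ {n} (i t : Fin n) → e i t ℚ.≤ 1ℚ
e-≤1 i t with i Fin.≟ t
... | yes _ = ℚP.≤-refl
... | no _  = 0≤1

edgeVec : ∀ {n} → Fin n → Fin n → Point n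
edgeVec i j t = e i t - e j t

dot-cong : ∀ {n} (c : Point n) {x y : Point n} → x ≋ y → c · x ≡ c · y
dot-cong c x≋y = ∑-cong (λ t → cong (c t *_) (x≋y t))

dot-origin : ∀ {n} (c : Point n) {x : Point n} → x ≋ 𝟎 → c · x ≡ 0ℚ
dot-origin c x≋0 = trans (dot-cong c x≋0) (∑-zero (λ t → ℚP.*-zeroʳ (c t)))

dot-basis : ∀ {n} (c : Point n) (i : Fin n) → c · e i ≡ c i
dot-basis c i = trans (∑-single i (λ t i≢t → trans (cong (c t *_) (e-off i≢t)) (ℚP.*-zeroʳ (c t))))
  (trans (cong (c i *_) (e-on i)) (ℚP.*-identityʳ (c i)))

dot-edge : ∀ {n} (c : Point n) {i j : Fin n} {x : Point n} → x ≋ edgeVec i j → c · x ≡ c i - c j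
dot-edge c {i} {j} {x} x≋eᵢ-eⱼ = begin
  c · x                                              ≡⟨ dot-cong c x≋eᵢ-eⱼ ⟩
  ∑ (λ t → c t * (e i t - e j t))                    ≡⟨ ∑-cong (λ t → distrib (c t) (e i t) (e j t)) ⟩
  ∑ (λ t → c t * e i t + - (c t * e j t))            ≡⟨ ∑-+ (λ t → c t * e i t) (λ t → - (c t * e j t)) ⟩
  c · e i + ∑ (λ t → - (c t * e j t))                ≡⟨ cong₂ _+_ (dot-basis c i) (∑-neg (λ t → c t * e j t)) ⟩
  c i + - (c · e j)                                  ≡⟨ cong (λ z → c i - z) (dot-basis c j) ⟩
  c i - c j                                          ∎
  where
  open ≡-Reasoning
  open +-*-Solver
  distrib : ∀ a x y → a * (x - y) ≡ a * x + - (a * y)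
  distrib = solve 3 (λ a x y → a :* (x :- y) := a :* x :+ (:- (a :* y))) refl

dot-combination : ∀ {n m} (c : Point n) (w : Fin m → ℚ) (p : Fin m → Point n) (x : Point n) →
  (∀ t → ∑ (λ k → w k * p k t) ≡ x t) → c · x ≡ ∑ (λ k → w k * (c · p k))
dot-combination c w p x x≡∑wp = begin
  ∑ (λ t → c t * x t)                        ≡⟨ ∑-cong (λ t → cong (c t *_) (sym (x≡∑wp t))) ⟩
  ∑ (λ t → c t * ∑ (λ k → w k * p k t))      ≡⟨ ∑-cong (λ t → sym (∑-* (c t) (λ k → w k * p k t))) ⟩
  ∑ (λ t → ∑ (λ k → c t * (w k * p k t)))    ≡⟨ ∑-swap (λ t k → c t * (w k * p k t)) ⟩
  ∑ (λ k → ∑ (λ t → c t * (w k * p k t)))    ≡⟨ ∑-cong (λ k → trans (∑-cong (λ t → swap-weight (c t) (w k) (p k t)))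
                                                                    (∑-* (w k) (λ t → c t * p k t))) ⟩
  ∑ (λ k → w k * (c · p k))                  ∎
  where
  open ≡-Reasoning
  open +-*-Solver
  swap-weight : ∀ a b d → a * (b * d) ≡ b * (a * d)
  swap-weight = solve 3 (λ a b d → a :* (b :* d) := b :* (a :* d)) refl

generator∈hull : ∀ {n} {S : Point n → Set} {p : Point n} → S p → Conv S p
generator∈hull {p = p} p∈S =
  1 , (λ _ → p) , (λ _ → 1ℚ) , (λ _ → p∈S) , (λ _ → 0≤1) , refl ,
  λ t → trans (ℚP.+-identityʳ _) (ℚP.*-identityˡ (p t))

conv-mono : ∀ {n} {S S′ : Point n → Set} → (∀ p → S p → S′ p) → ∀ x → Conv S x → Conv S′ x
conv-mono S⊆S′ x (m , p , w , p∈S , w≥0 , ∑w≡1 , x≡∑wp) = m , p , w , (λ k → S⊆S′ (p k) (p∈S k)) , w≥0 , ∑w≡1 , x≡∑wp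

hull-bound : ∀ {n} {S : Point n → Set} {c : Point n} {b : ℚ} →
  (∀ p → S p → c · p ℚ.≤ b) → ∀ x → Conv S x → c · x ℚ.≤ b
hull-bound {c = c} {b} c≤b x (m , p , w , p∈S , w≥0 , ∑w≡1 , x≡∑wp) = begin
  c · x                      ≡⟨ dot-combination c w p x x≡∑wp ⟩
  ∑ (λ k → w k * (c · p k))  ≤⟨ ∑-mono (λ k → ℚP.*-monoˡ-≤-nonNeg (w k) {{ℚ.nonNegative (w≥0 k)}} (c≤b (p k) (p∈S k))) ⟩
  ∑ (λ k → w k * b)          ≡⟨ ∑-cong (λ k → ℚP.*-comm (w k) b) ⟩
  ∑ (λ k → b * w k)          ≡⟨ ∑-* b w ⟩
  b * ∑ w                    ≡⟨ cong (b *_) ∑w≡1 ⟩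
  b * 1ℚ                     ≡⟨ ℚP.*-identityʳ b ⟩
  b                          ∎
  where open ℚP.≤-Reasoning

hull-zero : ∀ {n} {T : Point n → Set} {c : Point n} →
  (∀ p → T p → c · p ≡ 0ℚ) → ∀ x → Conv T x → c · x ≡ 0ℚ
hull-zero {c = c} c≡0 x (m , p , w , p∈T , _ , _ , x≡∑wp) = trans (dot-combination c w p x x≡∑wp)
  (∑-zero (λ k → trans (cong (w k *_) (c≡0 (p k) (p∈T k))) (ℚP.*-zeroʳ (w k))))

-- If c ≤ 0 on S, a point of Conv S on the hyperplane c · x = 0 is a convex combination
-- of generators on that hyperplane: the generators with c · pₖ < 0 carry weight 0 and
-- may be replaced by any point t₀ of T ⊇ S ∩ {c · p = 0}.
hull-cut : ∀ {n} {S T : Point n → Set} {c t₀ : Point n} → T t₀ →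
  (∀ p → S p → c · p ℚ.≤ 0ℚ) → (∀ p → S p → c · p ≡ 0ℚ → T p) →
  ∀ x → Conv S x → c · x ≡ 0ℚ → Conv T x
hull-cut {n} {S} {T} {c} {t₀} t₀∈T c≤0 cut⊆T x (m , p , w , p∈S , w≥0 , ∑w≡1 , x≡∑wp) c·x≡0 =
  m , p′ , w , p′∈T , w≥0 , ∑w≡1 , λ t → trans (∑-cong (same-term t)) (x≡∑wp t)
  where
  term≤0 : ∀ k → w k * (c · p k) ℚ.≤ 0ℚ
  term≤0 k = weight*nonpos (w≥0 k) (c≤0 (p k) (p∈S k))
  term≡0 : ∀ k → w k * (c · p k) ≡ 0ℚ
  term≡0 = ∑-nonpos-zero term≤0 (trans (sym (dot-combination c w p x x≡∑wp)) c·x≡0)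
  p′ : Fin m → Point n
  p′ k with c · p k ℚP.<? 0ℚ
  ... | yes _ = t₀
  ... | no _  = p k
  p′∈T : ∀ k → T (p′ k)
  p′∈T k with c · p k ℚP.<? 0ℚ
  ... | yes _   = t₀∈T
  ... | no c≮0 = cut⊆T (p k) (p∈S k) (ℚP.≤-antisym (c≤0 (p k) (p∈S k)) (ℚP.≮⇒≥ c≮0))
  same-term : ∀ t k → w k * p′ k t ≡ w k * p k t
  same-term t k with c · p k ℚP.<? 0ℚ
  ... | no _   = refl
  ... | yes c<0 = trans (weightless (t₀ t)) (sym (weightless (p k t)))
    where
    weightless : ∀ y → w k * y ≡ 0ℚ
    weightless y = trans (cong (_* y) (weight-vanishes (w≥0 k) c<0 (term≡0 k))) (ℚP.*-zeroˡ y)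

hull-face : ∀ {n} {S T : Point n → Set} (c : Point n) {t₀ : Point n} → T t₀ →
  (∀ p → S p → c · p ℚ.≤ 0ℚ) → (∀ p → T p ⇔ (S p × c · p ≡ 0ℚ)) → IsFace (Conv T) (Conv S)
hull-face {S = S} {T} c t₀∈T c≤0 T⇔cut = c , 0ℚ , hull-bound {c = c} c≤0 , λ x → mk⇔
  (λ x∈T → conv-mono T⊆S x x∈T , hull-zero {T = T} {c} c≡0 x x∈T)
  (λ (x∈S , c·x≡0) → hull-cut {S = S} {c = c} t₀∈T c≤0 cut⊆T x x∈S c·x≡0)
  where
  T⊆S : ∀ p → T p → S p
  T⊆S p = proj₁ ∘ to (T⇔cut p)
  c≡0 : ∀ p → T p → c · p ≡ 0ℚ
  c≡0 p = proj₂ ∘ to (T⇔cut p)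
  cut⊆T : ∀ p → S p → c · p ≡ 0ℚ → T p
  cut⊆T p p∈S c·p≡0 = from (T⇔cut p) (p∈S , c·p≡0)

Generator : ∀ {n} → Graph n → Point n → Set
Generator G x = (x ≋ 𝟎) ⊎ (∃[ i ] ∃[ j ] (G i j × (x ≋ edgeVec i j)))

⊎-finite : ∀ {m} {A : Set} {B : Fin m → Set} → (∀ k → A ⊎ B k) → A ⊎ (∀ k → B k)
⊎-finite {zero}  _ = inj₂ λ ()
⊎-finite {suc m} {B = B} A⊎B with A⊎B zero | ⊎-finite {B = B ∘ suc} (A⊎B ∘ suc)
... | inj₁ a | _       = inj₁ a
... | inj₂ _ | inj₁ a  = inj₁ a
... | inj₂ b | inj₂ bs = inj₂ λ { zero → b ; (suc k) → bs k }

-- (e_{i,a} - e_{j,a}) - (e_{i,b} - e_{j,b}) ≤ 1 unless (a, b) = (i, j): the first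
-- difference is at most 0 if a ≠ i and the second at least 0 if b ≠ j.
edge-coordinates : ∀ {n} (i j a b : Fin n) → (a ≡ i × b ≡ j) ⊎ (edgeVec i j a - edgeVec i j b ℚ.≤ 1ℚ)
edge-coordinates i j a b with a Fin.≟ i | b Fin.≟ j
... | yes a≡i | yes b≡j = inj₁ (a≡i , b≡j)
... | no a≢i  | _       = inj₂ (sub-mono-≤
        (sub-mono-≤ (ℚP.≤-reflexive (e-off (a≢i ∘ sym))) (e-nonneg j a))
        (sub-mono-≤ (e-nonneg i b) (e-≤1 j b)))
... | yes _   | no b≢j  = inj₂ (sub-mono-≤
        (sub-mono-≤ (e-≤1 i a) (e-nonneg j a))
        (sub-mono-≤ (e-nonneg i b) (ℚP.≤-reflexive (e-off (b≢j ∘ sym)))))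

edge-pairing : ∀ {n} {G : Graph n} {i j : Fin n} {x : Point n} →
  Generator G x → G i j ⊎ (edgeVec i j · x ℚ.≤ 1ℚ)
edge-pairing {i = i} {j} (inj₁ x≋0) = inj₂ (subst (ℚ._≤ 1ℚ) (sym (dot-origin (edgeVec i j) x≋0)) 0≤1)
edge-pairing {i = i} {j} (inj₂ (a , b , gab , x≋eₐ-e_b)) with edge-coordinates i j a b
... | inj₁ (refl , refl) = inj₁ gab
... | inj₂ pairing≤1    = inj₂ (subst (ℚ._≤ 1ℚ) (sym (dot-edge (edgeVec i j) x≋eₐ-e_b)) pairing≤1)

-- eᵢ - eⱼ (i ≠ j) lies in Q̃_G only if (i, j) is an edge: otherwise the functional eᵢ - eⱼ
-- is at most 1 on all generators, hence on the hull, but it takes the value 2 at eᵢ - eⱼ.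
edge-of-hull : ∀ {n} (G : Graph n) {i j : Fin n} → i ≢ j → Qtilde G (edgeVec i j) → G i j
edge-of-hull G {i} {j} i≢j (m , p , w , p∈G , hull) with ⊎-finite (λ k → edge-pairing {i = i} {j} (p∈G k))
... | inj₁ gij       = gij
... | inj₂ pairing≤1 = ⊥-elim (ℚP.<-irrefl refl (ℚP.<-≤-trans 1<2 2≤1))
  where
  d = edgeVec i j
  d·d≡2 : d · d ≡ 1ℚ + 1ℚ
  d·d≡2 = trans (dot-edge d (λ _ → refl))
    (cong₂ _-_ (cong₂ _-_ (e-on i) (e-off (i≢j ∘ sym))) (cong₂ _-_ (e-off i≢j) (e-on j)))
  2≤1 : 1ℚ + 1ℚ ℚ.≤ 1ℚ
  2≤1 = subst (ℚ._≤ 1ℚ) d·d≡2 (hull-bound {S = λ q → d · q ℚ.≤ 1ℚ} {c = d} (λ _ d·q≤1 → d·q≤1) d (m , p , w , pairing≤1 , hull))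
  1<2 : 1ℚ ℚ.< 1ℚ + 1ℚ
  1<2 = toWitness {a? = 1ℚ ℚP.<? (1ℚ + 1ℚ)} tt

IsLevelGraph : ∀ {n} → Graph n → Set
IsLevelGraph {n} H = Σ (Point n) λ c →
  (∀ i j → K n i j → c i ℚ.≤ c j) × (∀ i j → H i j ⇔ (K n i j × c i ≡ c j))

levelGraph⇒face : ∀ {n} {H : Graph n} → IsLevelGraph H → IsFace (Qtilde H) (Qtilde (K n))
levelGraph⇒face {n} {H} (c , c-mono , H⇔level) = hull-face c (inj₁ λ _ → refl) c≤0 generator⇔
  where
  c≤0 : ∀ p → Generator (K n) p → c · p ℚ.≤ 0ℚ
  c≤0 p (inj₁ p≋0)               = ℚP.≤-reflexive (dot-origin c p≋0)
  c≤0 p (inj₂ (i , j , i<j , p≋)) = subst (ℚ._≤ 0ℚ) (sym (dot-edge c p≋)) (≤⇒sub≤0 (c-mono i j i<j))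
  generator⇔ : ∀ p → Generator H p ⇔ (Generator (K n) p × c · p ≡ 0ℚ)
  generator⇔ p = mk⇔ to′ from′
    where
    to′ : Generator H p → Generator (K n) p × c · p ≡ 0ℚ
    to′ (inj₁ p≋0)             = inj₁ p≋0 , dot-origin c p≋0
    to′ (inj₂ (i , j , h , p≋)) with to (H⇔level i j) h
    ... | i<j , cᵢ≡cⱼ = inj₂ (i , j , i<j , p≋) , trans (dot-edge c p≋) (≡⇒sub≡0 cᵢ≡cⱼ)
    from′ : Generator (K n) p × c · p ≡ 0ℚ → Generator H p
    from′ (inj₁ p≋0 , _)                     = inj₁ p≋0
    from′ (inj₂ (i , j , i<j , p≋) , c·p≡0) =
      inj₂ (i , j , from (H⇔level i j) (i<j , sub≡0⇒≡ _ _ (trans (sym (dot-edge c p≋)) c·p≡0)) , p≋)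

face⇒levelGraph : ∀ {n} {H : Graph n} → SubgraphOfK H → IsFace (Qtilde H) (Qtilde (K n)) → IsLevelGraph H
face⇒levelGraph {n} {H} H⊆K (c , b , valid , face⇔) = c , c-mono , H⇔level
  where
  -- the origin lies on the face, so the supporting hyperplane passes through it
  b≡0 : b ≡ 0ℚ
  b≡0 = trans (sym (proj₂ (to (face⇔ 𝟎) (generator∈hull {S = Generator H} (inj₁ λ _ → refl))))) (dot-origin c λ _ → refl)
  edge∈Q : ∀ {G : Graph n} {i j} → G i j → Qtilde G (edgeVec i j)
  edge∈Q {G} {i} {j} gij = generator∈hull {S = Generator G} (inj₂ (i , j , gij , λ _ → refl))
  c-mono : ∀ i j → K n i j → c i ℚ.≤ c j
  c-mono i j i<j = sub≤0⇒≤ (subst₂ ℚ._≤_ (dot-edge c (λ _ → refl)) b≡0 (valid _ (edge∈Q {K n} i<j)))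
  H⇔level : ∀ i j → H i j ⇔ (K n i j × c i ≡ c j)
  H⇔level i j = mk⇔
    (λ h → H⊆K i j h , sub≡0⇒≡ _ _ (trans (sym (dot-edge c (λ _ → refl)))
                                        (trans (proj₂ (to (face⇔ _) (edge∈Q h))) b≡0)))
    (λ (i<j , cᵢ≡cⱼ) → edge-of-hull H (λ i≡j → ℕP.<-irrefl (cong toℕ i≡j) i<j)
      (from (face⇔ _) (edge∈Q {K n} i<j , trans (dot-edge c (λ _ → refl)) (trans (≡⇒sub≡0 cᵢ≡cⱼ) (sym b≡0)))))

Increasing : ∀ {m} → (Fin (suc m) → ℕ) → Set
Increasing {m} ns = ∀ (k : Fin m) → ns (inject₁ k) ℕ.< ns (suc k)

SameBlock : ∀ {m} → (Fin (suc m) → ℕ) → ℕ → ℕ → Set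
SameBlock {m} ns i j = ∃[ k ] ((ns (inject₁ k) ℕ.≤ i) × (i ℕ.< ns (suc k)) ×
                               (ns (inject₁ k) ℕ.≤ j) × (j ℕ.< ns (suc k)))

first<suc : ∀ {m} (ns : Fin (suc m) → ℕ) → Increasing ns → ∀ k → ns zero ℕ.< ns (suc k)
first<suc ns inc zero    = inc zero
first<suc ns inc (suc k) = ℕP.<-trans (inc zero) (first<suc (tail ns) (inc ∘ suc) k)

first≤ : ∀ {m} (ns : Fin (suc m) → ℕ) → Increasing ns → ∀ k → ns zero ℕ.≤ ns k
first≤ ns inc zero    = ℕP.≤-refl
first≤ ns inc (suc k) = ℕP.<⇒≤ (first<suc ns inc k)

sameBlock-first : ∀ {m} (ns : Fin (suc (suc m)) → ℕ) {i j} → Increasing ns →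
  ns zero ℕ.≤ i → i ℕ.< ns (suc zero) → ns zero ℕ.≤ j → SameBlock ns i j ⇔ j ℕ.< ns (suc zero)
sameBlock-first ns {i} {j} inc n₀≤i i<n₁ n₀≤j = mk⇔ to′ (λ j<n₁ → zero , n₀≤i , i<n₁ , n₀≤j , j<n₁)
  where
  to′ : SameBlock ns i j → j ℕ.< ns (suc zero)
  to′ (zero  , _ , _ , _ , j<n₁) = j<n₁
  to′ (suc k , nₖ≤i , _)         = ⊥-elim (ℕP.<⇒≱ i<n₁ (ℕP.≤-trans (first≤ (tail ns) (inc ∘ suc) (inject₁ k)) nₖ≤i))

sameBlock-tail : ∀ {m} (ns : Fin (suc (suc m)) → ℕ) {i j} → ns (suc zero) ℕ.≤ i →
  SameBlock ns i j ⇔ SameBlock (tail ns) i j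
sameBlock-tail ns {i} {j} n₁≤i = mk⇔ to′ (λ (k , inside) → suc k , inside)
  where
  to′ : SameBlock ns i j → SameBlock (tail ns) i j
  to′ (zero  , _ , i<n₁ , _) = ⊥-elim (ℕP.<⇒≱ i<n₁ n₁≤i)
  to′ (suc k , inside)       = k , inside

sameBlock-lowerFirst : ∀ {m} (ns : Fin (suc m) → ℕ) {a i j} → a ℕ.≤ ns zero →
  ns zero ℕ.≤ i → ns zero ℕ.≤ j → SameBlock (a ∷ tail ns) i j ⇔ SameBlock ns i j
sameBlock-lowerFirst ns a≤n₀ n₀≤i n₀≤j = mk⇔
  (λ { (zero , _ , i< , _ , j<) → zero , n₀≤i , i< , n₀≤j , j< ; (suc k , inside) → suc k , inside })
  (λ { (zero , _ , i< , _ , j<) → zero , ℕP.≤-trans a≤n₀ n₀≤i , i< , ℕP.≤-trans a≤n₀ n₀≤j , j<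
     ; (suc k , inside) → suc k , inside })

-- The block index: the number of boundaries n₁, n₂, … that lie at or below i.
blockIndex : ∀ {m} → (Fin (suc m) → ℕ) → ℕ → ℕ
blockIndex {zero}  ns i = 0
blockIndex {suc m} ns i with i <? ns (suc zero)
... | yes _ = 0
... | no _  = suc (blockIndex (tail ns) i)

blockIndex-mono : ∀ {m} (ns : Fin (suc m) → ℕ) {i j} → i ℕ.≤ j → blockIndex ns i ℕ.≤ blockIndex ns j
blockIndex-mono {zero}  ns i≤j = z≤n
blockIndex-mono {suc m} ns {i} {j} i≤j with i <? ns (suc zero) | j <? ns (suc zero)
... | yes _   | _       = z≤n
... | no i≮n₁ | yes j<n₁ = ⊥-elim (i≮n₁ (ℕP.≤-<-trans i≤j j<n₁))
... | no _    | no _    = ℕ.s≤s (blockIndex-mono (tail ns) i≤j)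

sameBlock⇔blockIndex : ∀ {m} (ns : Fin (suc m) → ℕ) {i j} → Increasing ns →
  ns zero ℕ.≤ i → i ℕ.≤ j → j ℕ.< ns (fromℕ m) → SameBlock ns i j ⇔ (blockIndex ns i ≡ blockIndex ns j)
sameBlock⇔blockIndex {zero} _ _ n₀≤i i≤j j<n₀ = ⊥-elim (ℕP.<⇒≱ j<n₀ (ℕP.≤-trans n₀≤i i≤j))
sameBlock⇔blockIndex {suc m} ns {i} {j} inc n₀≤i i≤j j<nₘ with i <? ns (suc zero) | j <? ns (suc zero)
... | yes i<n₁ | yes j<n₁ = mk⇔ (λ _ → refl) (λ _ → from (sameBlock-first ns inc n₀≤i i<n₁ n₀≤j′) j<n₁)
  where n₀≤j′ = ℕP.≤-trans n₀≤i i≤j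
... | yes i<n₁ | no j≮n₁  = mk⇔ (λ same → ⊥-elim (j≮n₁ (to (sameBlock-first ns inc n₀≤i i<n₁ (ℕP.≤-trans n₀≤i i≤j)) same))) λ ()
... | no i≮n₁  | yes j<n₁ = ⊥-elim (i≮n₁ (ℕP.≤-<-trans i≤j j<n₁))
... | no i≮n₁  | no _     = Eq.trans (sameBlock-tail ns (ℕP.≮⇒≥ i≮n₁))
  (Eq.trans (sameBlock⇔blockIndex (tail ns) (inc ∘ suc) (ℕP.≮⇒≥ i≮n₁) i≤j j<nₘ) (mk⇔ (cong suc) ℕP.suc-injective))

-- The level sets of a monotone function on [a, N) are consecutive blocks.  This holds
-- for values in any partial order with decidable equality; the blocks are built from
-- the right, adding the point a either to the first block or as a new block.
module LevelSets {A : Set} {_≼_ : A → A → Set} (≼-po : IsPartialOrder _≡_ _≼_) (_≟_ : DecidableEquality A)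
                 (N : ℕ) (f : ℕ → A) (f-mono : ∀ {i j} → i ℕ.≤ j → j ℕ.< N → f i ≼ f j) where

  open IsPartialOrder ≼-po using (antisym; reflexive) renaming (trans to ≼-trans)

  LevelBlocks : ℕ → Set
  LevelBlocks a = ∃[ ℓ ] Σ (Fin (suc (suc ℓ)) → ℕ) λ ns →
    ns zero ≡ a × ns (fromℕ (suc ℓ)) ≡ N × Increasing ns ×
    (∀ i j → a ℕ.≤ i → i ℕ.≤ j → j ℕ.< N → (f i ≡ f j ⇔ SameBlock ns i j))

  lastBlock : ∀ {a} → suc a ≡ N → LevelBlocks a
  lastBlock {a} a+1≡N = 0 , (a ∷ suc a ∷ []) , refl , a+1≡N , (λ { zero → ℕP.n<1+n a }) , level
    where
    level : ∀ i j → a ℕ.≤ i → i ℕ.≤ j → j ℕ.< N → (f i ≡ f j ⇔ SameBlock (a ∷ suc a ∷ []) i j)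
    level i j a≤i i≤j j<N = mk⇔
      (λ _ → zero , a≤i , ℕP.≤-<-trans i≤j j<a+1 , ℕP.≤-trans a≤i i≤j , j<a+1)
      (λ _ → cong f (ℕP.≤-antisym i≤j (ℕP.≤-trans (ℕP.≤-pred j<a+1) a≤i)))
      where j<a+1 = subst (j ℕ.<_) (sym a+1≡N) j<N

  joinFirst : ∀ {a} → f a ≡ f (suc a) → LevelBlocks (suc a) → LevelBlocks a
  joinFirst {a} fa≡fa′ (ℓ , ns , n₀≡a+1 , nₗ≡N , inc , level) = ℓ , a ∷ tail ns , refl , nₗ≡N , inc′ , level′
    where
    n₀≤ : ∀ {x} → suc a ℕ.≤ x → ns zero ℕ.≤ x
    n₀≤ {x} = subst (ℕ._≤ x) (sym n₀≡a+1)
    a+1<n₁ : suc a ℕ.< ns (suc zero)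
    a+1<n₁ = subst (ℕ._< ns (suc zero)) n₀≡a+1 (inc zero)
    inc′ : Increasing (a ∷ tail ns)
    inc′ zero    = ℕP.<-trans (ℕP.n<1+n a) a+1<n₁
    inc′ (suc k) = inc (suc k)
    level′ : ∀ i j → a ℕ.≤ i → i ℕ.≤ j → j ℕ.< N → (f i ≡ f j ⇔ SameBlock (a ∷ tail ns) i j)
    level′ i j a≤i i≤j j<N with ℕP.m≤n⇒m<n∨m≡n a≤i
    ... | inj₁ a<i = Eq.trans (level i j a<i i≤j j<N)
      (Eq.sym (sameBlock-lowerFirst ns (subst (a ℕ.≤_) (sym n₀≡a+1) (ℕP.n≤1+n a)) (n₀≤ a<i) (n₀≤ (ℕP.≤-trans a<i i≤j))))
    ... | inj₂ refl with ℕP.m≤n⇒m<n∨m≡n i≤j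
    ...   | inj₂ refl = mk⇔ (λ _ → zero , ℕP.≤-refl , inc′ zero , ℕP.≤-refl , inc′ zero) (λ _ → refl)
    ...   | inj₁ a<j  = begin
      f a ≡ f j                  ≈⟨ mk⇔ (trans (sym fa≡fa′)) (trans fa≡fa′) ⟩
      f (suc a) ≡ f j            ≈⟨ level (suc a) j ℕP.≤-refl a<j j<N ⟩
      SameBlock ns (suc a) j     ≈⟨ sameBlock-first ns inc (n₀≤ ℕP.≤-refl) a+1<n₁ (n₀≤ a<j) ⟩
      j ℕ.< ns (suc zero)        ≈⟨ sameBlock-first (a ∷ tail ns) inc′ ℕP.≤-refl (inc′ zero) i≤j ⟨
      SameBlock (a ∷ tail ns) a j ∎
      where open import Relation.Binary.Reasoning.Setoid (⇔-setoid 0ℓ)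

  -- if f a ≠ f (a+1), then f a < f j for all j > a, so the point a is a block of its own
  newBlock : ∀ {a} → f a ≢ f (suc a) → LevelBlocks (suc a) → LevelBlocks a
  newBlock {a} fa≢fa′ (ℓ , ns , n₀≡a+1 , nₗ≡N , inc , level) = suc ℓ , a ∷ ns , refl , nₗ≡N , inc′ , level′
    where
    inc′ : Increasing (a ∷ ns)
    inc′ zero    = subst (a ℕ.<_) (sym n₀≡a+1) (ℕP.n<1+n a)
    inc′ (suc k) = inc k
    -- f a = f j with a < j would squeeze f (a+1) between f a and f j = f a
    fa≢fj : ∀ {j} → a ℕ.< j → j ℕ.< N → f a ≢ f j
    fa≢fj a<j j<N fa≡fj = fa≢fa′ (antisym (f-mono (ℕP.n≤1+n a) (ℕP.<-≤-trans (ℕ.s≤s a<j) j<N))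
                                         (≼-trans (f-mono a<j j<N) (reflexive (sym fa≡fj))))
    level′ : ∀ i j → a ℕ.≤ i → i ℕ.≤ j → j ℕ.< N → (f i ≡ f j ⇔ SameBlock (a ∷ ns) i j)
    level′ i j a≤i i≤j j<N with ℕP.m≤n⇒m<n∨m≡n a≤i
    ... | inj₁ a<i = Eq.trans (level i j a<i i≤j j<N)
      (Eq.sym (sameBlock-tail (a ∷ ns) (subst (ℕ._≤ i) (sym n₀≡a+1) a<i)))
    ... | inj₂ refl with ℕP.m≤n⇒m<n∨m≡n i≤j
    ...   | inj₂ refl = mk⇔ (λ _ → zero , ℕP.≤-refl , inc′ zero , ℕP.≤-refl , inc′ zero) (λ _ → refl)
    ...   | inj₁ a<j  = mk⇔ (λ fa≡fj → ⊥-elim (fa≢fj a<j j<N fa≡fj))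
      (λ same → ⊥-elim (ℕP.<⇒≱ (subst (j ℕ.<_) n₀≡a+1 (to (sameBlock-first (a ∷ ns) inc′ ℕP.≤-refl (inc′ zero) i≤j) same)) a<j))

  levelBlocks : ∀ d a → suc d ℕ.+ a ≡ N → LevelBlocks a
  levelBlocks zero    a a+1≡N = lastBlock a+1≡N
  levelBlocks (suc d) a d+a≡N = prepend (f a ≟ f (suc a)) (levelBlocks d (suc a) (trans (ℕP.+-suc (suc d) a) d+a≡N))
    where
    prepend : Dec (f a ≡ f (suc a)) → LevelBlocks (suc a) → LevelBlocks a
    prepend (yes fa≡fa′) = joinFirst fa≡fa′
    prepend (no fa≢fa′)  = newBlock fa≢fa′

ℕ→ℚ : ℕ → ℚ
ℕ→ℚ n = fromℤ (ℤ.+ n)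

ℕ→ℚ-mono : ∀ {m n} → m ℕ.≤ n → ℕ→ℚ m ℚ.≤ ℕ→ℚ n
ℕ→ℚ-mono m≤n = ℚ.*≤* (subst₂ ℤ._≤_ (sym (ℤP.*-identityʳ _)) (sym (ℤP.*-identityʳ _)) (ℤ.+≤+ m≤n))

ℕ→ℚ-injective : ∀ {m n} → ℕ→ℚ m ≡ ℕ→ℚ n → m ≡ n
ℕ→ℚ-injective eq = ℤP.+-injective (cong ℚ.numerator eq)

extend : ∀ {n} {A : Set} → (Fin (suc n) → A) → ℕ → A
extend {n} c t = c (t mod suc n)

toℕ-mod : ∀ {n x} → x ℕ.< suc n → toℕ (x mod suc n) ≡ x
toℕ-mod x<n+1 = trans (FinP.toℕ-fromℕ< _) (m<n⇒m%n≡m x<n+1)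

extend-toℕ : ∀ {n} {A : Set} (c : Fin (suc n) → A) (i : Fin (suc n)) → extend c (toℕ i) ≡ c i
extend-toℕ c i = cong c (FinP.toℕ-injective (toℕ-mod (FinP.toℕ<n i)))

extend-mono : ∀ {n} (c : Point (suc n)) → (∀ i j → K (suc n) i j → c i ℚ.≤ c j) →
  ∀ {s t} → s ℕ.≤ t → t ℕ.< suc n → extend c s ℚ.≤ extend c t
extend-mono c c-mono s≤t t<n+1 with ℕP.m≤n⇒m<n∨m≡n s≤t
... | inj₂ refl = ℚP.≤-refl
... | inj₁ s<t  = c-mono _ _ (subst₂ ℕ._<_ (sym (toℕ-mod (ℕP.<-trans s<t t<n+1))) (sym (toℕ-mod t<n+1)) s<t)

levelGraph⇔blocks : ∀ n (H : Graph (suc n)) → IsLevelGraph H ⇔ IsBlockDecomposition (suc n) H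
levelGraph⇔blocks n H = mk⇔ levelGraph⇒blocks blocks⇒levelGraph
  where
  levelGraph⇒blocks : IsLevelGraph H → IsBlockDecomposition (suc n) H
  levelGraph⇒blocks (c , c-mono , H⇔level)
    with LevelSets.levelBlocks ℚP.≤-isPartialOrder ℚP._≟_ (suc n) (extend c) (extend-mono c c-mono) n 0 (ℕP.+-identityʳ (suc n))
  ... | ℓ , ns , n₀≡0 , nₗ≡n+1 , inc , level = ℓ , ns , n₀≡0 , nₗ≡n+1 , inc , λ i j → Eq.trans (H⇔level i j) (mk⇔
    (λ (i<j , cᵢ≡cⱼ) → i<j , to (level′ i<j) (trans (extend-toℕ c i) (trans cᵢ≡cⱼ (sym (extend-toℕ c j)))))
    (λ (i<j , same) → i<j , trans (sym (extend-toℕ c i)) (trans (from (level′ i<j) same) (extend-toℕ c j))))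
    where
    level′ : ∀ {i j} → K (suc n) i j → (extend c (toℕ i) ≡ extend c (toℕ j) ⇔ SameBlock ns (toℕ i) (toℕ j))
    level′ {i} {j} i<j = level (toℕ i) (toℕ j) z≤n (ℕP.<⇒≤ i<j) (FinP.toℕ<n j)
  blocks⇒levelGraph : IsBlockDecomposition (suc n) H → IsLevelGraph H
  blocks⇒levelGraph (ℓ , ns , n₀≡0 , nₗ≡n+1 , inc , H⇔blocks) = c , c-mono , λ i j → Eq.trans (H⇔blocks i j) (mk⇔
    (λ (i<j , same) → i<j , cong ℕ→ℚ (to (index⇔ i<j) same))
    (λ (i<j , cᵢ≡cⱼ) → i<j , from (index⇔ i<j) (ℕ→ℚ-injective cᵢ≡cⱼ)))
    where
    c : Point (suc n)
    c t = ℕ→ℚ (blockIndex ns (toℕ t))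
    c-mono : ∀ i j → K (suc n) i j → c i ℚ.≤ c j
    c-mono i j i<j = ℕ→ℚ-mono (blockIndex-mono ns (ℕP.<⇒≤ i<j))
    index⇔ : ∀ {i j} → K (suc n) i j →
      SameBlock ns (toℕ i) (toℕ j) ⇔ (blockIndex ns (toℕ i) ≡ blockIndex ns (toℕ j))
    index⇔ {i} {j} i<j = sameBlock⇔blockIndex ns inc (subst (ℕ._≤ toℕ i) (sym n₀≡0) z≤n) (ℕP.<⇒≤ i<j)
      (subst (toℕ j ℕ.<_) (sym nₗ≡n+1) (FinP.toℕ<n j))

corollary5p9 : (n : ℕ) (H : Graph (suc n)) → SubgraphOfK H →
    IsFace (Qtilde H) (Qtilde (K (suc n))) ⇔ IsBlockDecomposition (suc n) H
corollary5p9 n H H⊆K = mk⇔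
  (λ face → to (levelGraph⇔blocks n H) (face⇒levelGraph H⊆K face))
  (λ blocks → levelGraph⇒face (from (levelGraph⇔blocks n H) blocks))
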